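{- Let $b\geq 2$, $\tau\in\{\tau^b_2,\tau^b_3\}$ and $E_0=\{(m,m)\mid 1\leq m\leq b\}\cup\{0\}$ (where $0$ is the group element). Let $H_3$ be the transition system defined in the context. (1) If $(sup_K,sig_K)$ is a $\tau$-region of $H_3$ that solves the ESSP atom $(k,h_{3,1,b-1})$, i.e. $sig_K(k)$ does not occur at $sup_K(h_{3,1,b-1})$ in $\tau$, then $sig_K(k)\in\{(1,0),(0,1)\}$ and $sig_K(z)\in E_0$. (2) There is a $\tau$-region $(sup_K,sig_K)$ of $H_3$ solving $(k,h_{3,1,b-1})$ with $sig_K(k)=(0,1)$ and $sig_K(z)=0$.
   Context: Type $\tau^b_2$: states $\{0,\dots,b\}$, events $(\{0,\dots,b\}^2\setminus\{(0,0)\})\cup\{0,\dots,b\}$ (the latter being group elements distinct from pairs); a pair $(m,n)$ maps $s$ to $s-m+n$ if $s\geq m$ and $s-m+n\leq b$ (undefined otherwise), a group element $e$ maps $s$ to $(s+e)\bmod(b+1)$. $\tau^b_3$ is $\tau^b_2$ with the events $\{(m,n)\mid 1\leq m,n\leq b\}$ removed. A $\tau$-region of a transition system $A$ is $(sup,sig)$, $sup:S_A\to S_\tau$, $sig:E_A\to E_\tau$, such that every transition $s\xrightarrow{e}s'$ of $A$ yields a transition $sup(s)\xrightarrow{sig(e)}sup(s')$ of $\tau$. $H_3$: states $h_{3,0,0},\dots,h_{3,0,b}$ and $h_{3,1,0},\dots,h_{3,1,b-1}$ (pairwise distinct), events $k,u,z$, initial state $h_{3,0,0}$, transitions $h_{3,0,j}\xrightarrow{k}h_{3,0,j+1}$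 for $0\leq j\leq b-1$, $h_{3,0,0}\xrightarrow{u}h_{3,1,0}$, $h_{3,1,j}\xrightarrow{k}h_{3,1,j+1}$ for $0\leq j\leq b-2$, and $h_{3,1,b-1}\xrightarrow{z}h_{3,0,b}$. -}

module Defs where

open import Data.Nat using (ℕ; zero; suc; _+_; _∸_; _≤_; _<_)
open import Data.Nat.DivMod using (_%_)
open import Data.Fin using (Fin; toℕ)
open import Data.Product using (Σ; _×_; ∃; ∃-syntax)
open import Data.Sum using (_⊎_)
open import Relation.Nullary using (¬_)
open import Relation.Binary.PropositionalEquality using (_≡_)
open import Data.Unit using (⊤)

-- The types of nets τ^b_2 and τ^b_3.
-- States: Fin (suc b) = {0,…,b}.
-- Events: pairs (m,n) (with (m,n) ≠ (0,0)) and group elements e,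
-- as two distinct constructors.

data Kind : Set where
  τ₂ τ₃ : Kind

data TEv (b : ℕ) : Set where
  pair : Fin (suc b) → Fin (suc b) → TEv b
  grp  : Fin (suc b) → TEv b

-- Which elements of TEv b are events of the type τ^b_κ.
-- τ^b_2: all pairs except (0,0), all group elements.
-- τ^b_3: additionally removes the pairs (m,n) with 1 ≤ m,n ≤ b,
--        i.e. keeps only pairs with m = 0 or n = 0.
IsEvent : (κ : Kind) (b : ℕ) → TEv b → Set
IsEvent τ₂ b (pair m n) = ¬ (toℕ m ≡ 0 × toℕ n ≡ 0)
IsEvent τ₃ b (pair m n) = ¬ (toℕ m ≡ 0 × toℕ n ≡ 0) × (toℕ m ≡ 0 ⊎ toℕ n ≡ 0)
IsEvent κ  b (grp e)    = ⊤

-- The (partial) transition function of τ, as a relation: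
-- Step b s e s'  means  s --e--> s'  in τ^b.
-- (m,n): defined iff s ≥ m and s - m + n ≤ b (the latter is
-- automatic since s' : Fin (suc b)), with s' = s - m + n.
-- e (group element): s' = (s + e) mod (b+1).
Step : (b : ℕ) → Fin (suc b) → TEv b → Fin (suc b) → Set
Step b s (pair m n) s' = toℕ m ≤ toℕ s × toℕ s' ≡ (toℕ s ∸ toℕ m) + toℕ n
Step b s (grp e)    s' = toℕ s' ≡ (toℕ s + toℕ e) % suc b

Occurs : (b : ℕ) → TEv b → Fin (suc b) → Set
Occurs b e s = ∃[ s' ] Step b s e s'

-- The transition system H_3 (for parameter b).
-- States h_{3,0,j} are  h0 j  (0 ≤ j ≤ b),  h_{3,1,j} are  h1 j  (0 ≤ j ≤ b-1).

data HState : Set where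
  h0 h1 : ℕ → HState

data HEv : Set where
  k u z : HEv

ValidH : ℕ → HState → Set
ValidH b (h0 j) = j ≤ b
ValidH b (h1 j) = j < b

data HTrans (b : ℕ) : HState → HEv → HState → Set where
  k0 : ∀ {j} → j < b → HTrans b (h0 j) k (h0 (suc j))
  u0 : HTrans b (h0 0) u (h1 0)
  k1 : ∀ {j} → suc j < b → HTrans b (h1 j) k (h1 (suc j))
  z1 : HTrans b (h1 (b ∸ 1)) z (h0 b)

record Region (κ : Kind) (b : ℕ) : Set where
  field
    sup   : HState → Fin (suc b)
    sig   : HEv → TEv b
    sigEv : ∀ e → IsEvent κ b (sig e)
    hom   : ∀ {s e s'} → HTrans b s e s' → Step b (sup s) (sig e) (sup s')
open Region public

SolvesK : ∀ {κ b} → Region κ b → Set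
SolvesK {κ} {b} R = ¬ Occurs b (sig R k) (sup R (h1 (b ∸ 1)))

Is10 : ∀ {b} → TEv b → Set
Is10 {b} e = ∃[ m ] ∃[ n ] (e ≡ pair m n × toℕ m ≡ 1 × toℕ n ≡ 0)

Is01 : ∀ {b} → TEv b → Set
Is01 {b} e = ∃[ m ] ∃[ n ] (e ≡ pair m n × toℕ m ≡ 0 × toℕ n ≡ 1)

InE0 : ∀ {b} → TEv b → Set
InE0 {b} e = (∃[ m ] (1 ≤ toℕ m × e ≡ pair m m)) ⊎ (∃[ g ] (toℕ g ≡ 0 × e ≡ grp g))

-- The argument rests on one conservation law of the type τ^b: a pair event
-- (m,n) leading from s to s' satisfies  s' + m = s + n.  Summed along the
-- k-path h_{3,0,0} → … → h_{3,0,b} of length b it gives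
--   sup(h_{3,0,b}) + b·m = sup(h_{3,0,0}) + b·n,
-- and since both supports lie in [0,b], the numbers m and n differ by at
-- most one, with the supports forced to the extreme values 0 and b when
-- they differ.  A loop (m,m) is excluded, since k would then also occur at
-- h_{3,1,b-1}; a group element occurs everywhere, so it is excluded too.
-- The two remaining cases give sig(k) = (0,1) or (1,0), and in both cases
-- the z-edge h_{3,1,b-1} → h_{3,0,b} turns out to be a loop in τ; every
-- loop event of τ lies in E_0.  Part (2) is witnessed by the region whose
-- support counts the k- and u-edges taken so far.

module Submission where

open import Defs
open import Data.Nat using (ℕ; _≤_)
open import Data.Fin using (zero)
open import Data.Product using (_×_; Σ-syntax)
open import Data.Sum using (_⊎_)
open import Relation.Binary.PropositionalEquality using (_≡_)

open import Data.Nat using (suc; _+_; _∸_; _*_; _<_; z≤n; s≤s; s≤s⁻¹)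
open import Data.Nat.Properties
open import Data.Nat.DivMod using (_%_; _/_; m%n<n; m<n⇒m%n≡m; m≡m%n+[m/n]*n)
open import Data.Fin using (Fin; toℕ; fromℕ<) renaming (suc to fsuc)
open import Data.Fin.Properties using (toℕ-fromℕ<; toℕ<n; toℕ≤pred[n]; toℕ-injective)
open import Data.Product using (_,_; proj₁; proj₂; map₁)
open import Data.Sum using (inj₁; inj₂)
open import Data.Empty using (⊥-elim)
open import Data.Unit using (tt)
open import Relation.Nullary using (¬_)
open import Relation.Binary.PropositionalEquality
  using (refl; sym; trans; cong; cong₂; subst; subst₂; module ≡-Reasoning)

pair-occurs : ∀ {b} {m n y : Fin (suc b)} →
  toℕ m ≤ toℕ y → toℕ y ∸ toℕ m + toℕ n ≤ b → Occurs b (pair m n) y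
pair-occurs m≤y fits = fromℕ< (s≤s fits) , m≤y , toℕ-fromℕ< (s≤s fits)

grp-occurs : ∀ {b} (g y : Fin (suc b)) → Occurs b (grp g) y
grp-occurs {b} g y = fromℕ< (m%n<n (toℕ y + toℕ g) (suc b)) , toℕ-fromℕ< _

pair-balance : ∀ {b} {s s' m n : Fin (suc b)} →
  Step b s (pair m n) s' → toℕ s' + toℕ m ≡ toℕ s + toℕ n
pair-balance {s = s} {s'} {m} {n} (m≤s , s'≡) = begin
  toℕ s' + toℕ m                 ≡⟨ cong (_+ toℕ m) s'≡ ⟩
  toℕ s ∸ toℕ m + toℕ n + toℕ m  ≡⟨ +-assoc (toℕ s ∸ toℕ m) (toℕ n) (toℕ m) ⟩
  toℕ s ∸ toℕ m + (toℕ n + toℕ m) ≡⟨ cong (toℕ s ∸ toℕ m +_) (+-comm (toℕ n) (toℕ m)) ⟩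
  toℕ s ∸ toℕ m + (toℕ m + toℕ n) ≡⟨ sym (+-assoc (toℕ s ∸ toℕ m) (toℕ m) (toℕ n)) ⟩
  toℕ s ∸ toℕ m + toℕ m + toℕ n  ≡⟨ cong (_+ toℕ n) (m∸n+n≡m m≤s) ⟩
  toℕ s + toℕ n                  ∎
  where open ≡-Reasoning

up-blocked⇒top : ∀ {b} {m n y : Fin (suc b)} → toℕ m ≡ 0 → toℕ n ≡ 1 →
  ¬ Occurs b (pair m n) y → toℕ y ≡ b
up-blocked⇒top {b} {m} {n} {y} m≡0 n≡1 blocked =
  ≤∧≮⇒≡ (toℕ≤pred[n] y) (λ y<b → blocked (pair-occurs m≤y (fits y<b)))
  where
  m≤y : toℕ m ≤ toℕ y
  m≤y = subst (_≤ toℕ y) (sym m≡0) z≤n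
  fits : toℕ y < b → toℕ y ∸ toℕ m + toℕ n ≤ b
  fits y<b rewrite m≡0 | n≡1 = subst (_≤ b) (+-comm 1 (toℕ y)) y<b

top⇒up-blocked : ∀ {b} {m n y : Fin (suc b)} → toℕ m ≡ 0 → toℕ n ≡ 1 →
  toℕ y ≡ b → ¬ Occurs b (pair m n) y
top⇒up-blocked {b} {m} {n} {y} m≡0 n≡1 y≡b (s' , step) =
  <-irrefl refl (subst (_< suc b) s'≡1+b (toℕ<n s'))
  where
  s'≡1+b : toℕ s' ≡ 1 + b
  s'≡1+b = begin
    toℕ s'         ≡⟨ sym (+-identityʳ (toℕ s')) ⟩
    toℕ s' + 0     ≡⟨ cong (toℕ s' +_) (sym m≡0) ⟩
    toℕ s' + toℕ m ≡⟨ pair-balance step ⟩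
    toℕ y + toℕ n  ≡⟨ cong₂ _+_ y≡b n≡1 ⟩
    b + 1          ≡⟨ +-comm b 1 ⟩
    1 + b          ∎
    where open ≡-Reasoning

down-blocked⇒bottom : ∀ {b} {m n y : Fin (suc b)} → toℕ m ≡ 1 → toℕ n ≡ 0 →
  ¬ Occurs b (pair m n) y → toℕ y ≡ 0
down-blocked⇒bottom {y = zero}   _   _   _       = refl
down-blocked⇒bottom {b} {m} {n} {fsuc t} m≡1 n≡0 blocked =
  ⊥-elim (blocked (pair-occurs m≤y fits))
  where
  m≤y : toℕ m ≤ suc (toℕ t)
  m≤y rewrite m≡1 = s≤s z≤n
  fits : suc (toℕ t) ∸ toℕ m + toℕ n ≤ b
  fits rewrite m≡1 | n≡0 | +-identityʳ (toℕ t) = <⇒≤ (toℕ<n t)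

grp-fixes⇒zero : ∀ {b} (p g : ℕ) → g < suc b → (p + g) % suc b ≡ p → g ≡ 0
grp-fixes⇒zero {b} p g g<N fixes =
  trans g≡qN (multiple-below N {q} (subst (_< N) g≡qN g<N))
  where
  N q : ℕ
  N = suc b
  q = (p + g) / N
  -- division with remainder of p + g, whose remainder is p by assumption
  g≡qN : g ≡ q * N
  g≡qN = +-cancelˡ-≡ p g (q * N) (trans (m≡m%n+[m/n]*n (p + g) N) (cong (_+ q * N) fixes))
  multiple-below : ∀ d {r} → r * d < d → r * d ≡ 0
  multiple-below d {0}     _   = refl
  multiple-below d {suc r} r<d = ⊥-elim (m+n≮n (r * d) d (subst (_< d) (+-comm d (r * d)) r<d))

pair-nonzero : ∀ κ {b} {m n : Fin (suc b)} → IsEvent κ b (pair m n) →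
  ¬ (toℕ m ≡ 0 × toℕ n ≡ 0)
pair-nonzero τ₂ ev = ev
pair-nonzero τ₃ ev = proj₁ ev

loop⇒E0 : ∀ {κ b} {e : TEv b} {p q : Fin (suc b)} → IsEvent κ b e →
  Step b p e q → toℕ p ≡ toℕ q → InE0 e
loop⇒E0 {e = grp g} {p} _ step p≡q =
  inj₂ (g , grp-fixes⇒zero (toℕ p) (toℕ g) (toℕ<n g) (sym (trans p≡q step)) , refl)
loop⇒E0 {κ} {b} {pair m n} {p} ev step p≡q =
  loop-pair ev (+-cancelˡ-≡ (toℕ p) (toℕ n) (toℕ m)
                 (sym (trans (cong (_+ toℕ m) p≡q) (pair-balance step))))
  where
  loop-pair : ∀ {m n : Fin (suc b)} → IsEvent κ b (pair m n) → toℕ n ≡ toℕ m →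
    InE0 (pair m n)
  loop-pair {zero}    ev′ n≡m = ⊥-elim (pair-nonzero κ ev′ (refl , n≡m))
  loop-pair {fsuc m′} _   n≡m = inj₁ (fsuc m′ , s≤s z≤n , cong (pair _) (toℕ-injective n≡m))

telescope : ∀ (m n : ℕ) (T : ℕ → ℕ) len →
  (∀ j → j < len → T (suc j) + m ≡ T j + n) → T len + len * m ≡ T 0 + len * n
telescope m n T 0       _    = refl
telescope m n T (suc l) step = begin
  T (suc l) + (m + l * m)  ≡⟨ sym (+-assoc (T (suc l)) m (l * m)) ⟩
  T (suc l) + m + l * m    ≡⟨ cong (_+ l * m) (step l (n<1+n l)) ⟩
  T l + n + l * m          ≡⟨ +-assoc (T l) n (l * m) ⟩
  T l + (n + l * m)        ≡⟨ cong (T l +_) (+-comm n (l * m)) ⟩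
  T l + (l * m + n)        ≡⟨ sym (+-assoc (T l) (l * m) n) ⟩
  T l + l * m + n          ≡⟨ cong (_+ n) (telescope m n T l (λ j j<l → step j (m<n⇒m<1+n j<l))) ⟩
  T 0 + l * n + n          ≡⟨ +-assoc (T 0) (l * n) n ⟩
  T 0 + (l * n + n)        ≡⟨ cong (T 0 +_) (+-comm (l * n) n) ⟩
  T 0 + (n + l * n)        ∎
  where open ≡-Reasoning

peel : ∀ B x y → x + B * suc y ≡ B + (x + B * y)
peel B x y = begin
  x + B * suc y     ≡⟨ cong (x +_) (*-suc B y) ⟩
  x + (B + B * y)   ≡⟨ sym (+-assoc x B (B * y)) ⟩
  x + B + B * y     ≡⟨ cong (_+ B * y) (+-comm x B) ⟩
  B + x + B * y     ≡⟨ +-assoc B x (B * y) ⟩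
  B + (x + B * y)   ∎
  where open ≡-Reasoning

overshoot : ∀ B a c n → 1 ≤ B → a ≤ B → a ≡ c + B * suc n → n ≡ 0 × a ≡ B × c ≡ 0
overshoot B a c n 1≤B a≤B a≡ = n≡0 , a≡B , m+n≡0⇒m≡0 c rest≡0
  where
  a≡B+rest : a ≡ B + (c + B * n)
  a≡B+rest = trans a≡ (peel B c n)
  rest≡0 : c + B * n ≡ 0
  rest≡0 = n≤0⇒n≡0 (+-cancelˡ-≤ B (c + B * n) 0
             (subst₂ _≤_ a≡B+rest (sym (+-identityʳ B)) a≤B))
  a≡B : a ≡ B
  a≡B = trans a≡B+rest (trans (cong (B +_) rest≡0) (+-identityʳ B))
  n≡0 : n ≡ 0
  n≡0 with m*n≡0⇒m≡0∨n≡0 B (m+n≡0⇒n≡0 c rest≡0)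
  ... | inj₁ B≡0 = ⊥-elim (<-irrefl (sym B≡0) 1≤B)
  ... | inj₂ n≡0 = n≡0

no-multiple : ∀ B x → x + B * 0 ≡ x
no-multiple B x = trans (cong (x +_) (*-zeroʳ B)) (+-identityʳ x)

bounded-multiples : ∀ B a c m n → 1 ≤ B → a ≤ B → c ≤ B → a + B * m ≡ c + B * n →
  (m ≡ n) ⊎ (n ≡ suc m × a ≡ B × c ≡ 0) ⊎ (m ≡ suc n × a ≡ 0 × c ≡ B)
bounded-multiples B a c 0 0 _ _ _ _ = inj₁ refl
bounded-multiples B a c 0 (suc n) 1≤B a≤B _ eq
  with overshoot B a c n 1≤B a≤B (trans (sym (no-multiple B a)) eq)
... | n≡0 , a≡B , c≡0 = inj₂ (inj₁ (cong suc n≡0 , a≡B , c≡0))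
bounded-multiples B a c (suc m) 0 1≤B _ c≤B eq
  with overshoot B c a m 1≤B c≤B (trans (sym (no-multiple B c)) (sym eq))
... | m≡0 , c≡B , a≡0 = inj₂ (inj₂ (cong suc m≡0 , a≡0 , c≡B))
bounded-multiples B a c (suc m) (suc n) 1≤B a≤B c≤B eq
  with bounded-multiples B a c m n 1≤B a≤B c≤B
         (+-cancelˡ-≡ B (a + B * m) (c + B * n) (trans (sym (peel B a m)) (trans eq (peel B c n))))
... | inj₁ m≡n                     = inj₁ (cong suc m≡n)
... | inj₂ (inj₁ (n≡1+m , ends))   = inj₂ (inj₁ (cong suc n≡1+m , ends))
... | inj₂ (inj₂ (m≡1+n , ends))   = inj₂ (inj₂ (cong suc m≡1+n , ends))

-- Part (1): analysis of a region solving (k, h_{3,1,b-1}), for b = c + 2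

module SolvingRegion {κ : Kind} (c : ℕ) (R : Region κ (suc (suc c))) (solves : SolvesK R) where

  b : ℕ
  b = suc (suc c)

  -- the support of h_{3,1,b-1}, where k must be blocked
  Y : Fin (suc b)
  Y = sup R (h1 (suc c))

  T : ℕ → ℕ
  T j = toℕ (sup R (h0 j))

  T≤b : ∀ j → T j ≤ b
  T≤b j = toℕ≤pred[n] (sup R (h0 j))

  module PairSignature (m n : Fin (suc b)) (sig-k : sig R k ≡ pair m n) where

    M N : ℕ
    M = toℕ m
    N = toℕ n

    k-step : ∀ {s s'} → HTrans b s k s' → Step b (sup R s) (pair m n) (sup R s')
    k-step t = subst (λ e → Step b _ e _) sig-k (hom R t)

    blocked : ¬ Occurs b (pair m n) Y
    blocked = subst (λ e → ¬ Occurs b e Y) sig-k solves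

    path-balance : T b + b * M ≡ T 0 + b * N
    path-balance = telescope M N T b (λ j j<b → pair-balance (k-step (k0 j<b)))

    -- A loop (m,m) entering h_{3,1,b-1} along k would also occur there.
    not-loop : ¬ M ≡ N
    not-loop M≡N = blocked (pair-occurs M≤Y fits)
      where
      P : Fin (suc b)
      P = sup R (h1 c)
      enter : Step b P (pair m n) Y
      enter = k-step (k1 ≤-refl)
      Y≡P : toℕ Y ≡ toℕ P
      Y≡P = +-cancelʳ-≡ M (toℕ Y) (toℕ P)
              (trans (pair-balance enter) (cong (toℕ P +_) (sym M≡N)))
      M≤Y : M ≤ toℕ Y
      M≤Y = subst (M ≤_) (sym Y≡P) (proj₁ enter)
      fits : toℕ Y ∸ M + N ≤ b
      fits = subst (_≤ b) (sym (trans (cong (toℕ Y ∸ M +_) (sym M≡N)) (m∸n+n≡m M≤Y)))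
               (toℕ≤pred[n] Y)

    -- n = m + 1 forces the path to climb from 0 to b, hence (m,n) = (0,1).
    climbing : N ≡ suc M → T b ≡ b → T 0 ≡ 0 → Is01 (pair m n) × toℕ Y ≡ T b
    climbing N≡1+M Tb≡b T0≡0 = (m , n , refl , M≡0 , N≡1) , trans Y≡b (sym Tb≡b)
      where
      M≡0 : M ≡ 0
      M≡0 = n≤0⇒n≡0 (subst (M ≤_) T0≡0 (proj₁ (k-step (k0 {j = 0} (s≤s z≤n)))))
      N≡1 : N ≡ 1
      N≡1 = trans N≡1+M (cong suc M≡0)
      Y≡b : toℕ Y ≡ b
      Y≡b = up-blocked⇒top M≡0 N≡1 blocked

    -- m = n + 1 forces the path to descend from b to 0; its last edge
    -- starts at 1, so m ≤ 1 and (m,n) = (1,0).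
    descending : M ≡ suc N → T b ≡ 0 → T 0 ≡ b → Is10 (pair m n) × toℕ Y ≡ T b
    descending M≡1+N Tb≡0 _ = (m , n , refl , M≡1 , N≡0) , trans Y≡0 (sym Tb≡0)
      where
      last : Step b (sup R (h0 (suc c))) (pair m n) (sup R (h0 b))
      last = k-step (k0 ≤-refl)
      -- T b + M = T (b-1) + N with T b = 0 and M = N + 1
      T[b-1]≡1 : T (suc c) ≡ 1
      T[b-1]≡1 = +-cancelʳ-≡ N (T (suc c)) 1 (sym (begin
        1 + N          ≡⟨ sym M≡1+N ⟩
        M              ≡⟨ cong (_+ M) (sym Tb≡0) ⟩
        T b + M        ≡⟨ pair-balance last ⟩
        T (suc c) + N  ∎))
        where open ≡-Reasoning
      M≤1 : M ≤ 1
      M≤1 = subst (M ≤_) T[b-1]≡1 (proj₁ last)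
      N≡0 : N ≡ 0
      N≡0 = n≤0⇒n≡0 (s≤s⁻¹ (subst (_≤ 1) M≡1+N M≤1))
      M≡1 : M ≡ 1
      M≡1 = trans M≡1+N (cong suc N≡0)
      Y≡0 : toℕ Y ≡ 0
      Y≡0 = down-blocked⇒bottom M≡1 N≡0 blocked

    classification : (Is10 (pair m n) ⊎ Is01 (pair m n)) × toℕ Y ≡ T b
    classification with bounded-multiples b (T b) (T 0) M N (s≤s z≤n) (T≤b b) (T≤b 0) path-balance
    ... | inj₁ M≡N                     = ⊥-elim (not-loop M≡N)
    ... | inj₂ (inj₁ (N≡1+M , ends))   = map₁ inj₂ (climbing N≡1+M (proj₁ ends) (proj₂ ends))
    ... | inj₂ (inj₂ (M≡1+N , ends))   = map₁ inj₁ (descending M≡1+N (proj₁ ends) (proj₂ ends))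

  k-signature : (e : TEv b) → sig R k ≡ e → (Is10 e ⊎ Is01 e) × toℕ Y ≡ T b
  k-signature (grp g)    sig-k = ⊥-elim (solves (subst (λ e → Occurs b e Y) (sym sig-k) (grp-occurs g Y)))
  k-signature (pair m n) sig-k = PairSignature.classification m n sig-k

  -- The z-edge h_{3,1,b-1} → h_{3,0,b} is therefore a loop in τ.
  signatures : (Is10 (sig R k) ⊎ Is01 (sig R k)) × InE0 (sig R z)
  signatures = proj₁ k-sig , loop⇒E0 (sigEv R z) (hom R z1) (proj₂ k-sig)
    where
    k-sig : (Is10 (sig R k) ⊎ Is01 (sig R k)) × toℕ Y ≡ T b
    k-sig = k-signature (sig R k) refl

-- Part (2): a solving region with sig(k) = (0,1) and sig(z) = 0, for b ≥ 1

-- Saturating embedding of ℕ into the states {0,…,b} of τ^b.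
embed : ∀ b → ℕ → Fin (suc b)
embed b j = fromℕ< (s≤s (m⊓n≤n j b))

embed-exact : ∀ b j → j ≤ b → toℕ (embed b j) ≡ j
embed-exact b j j≤b = trans (toℕ-fromℕ< (s≤s (m⊓n≤n j b))) (m≤n⇒m⊓n≡m j≤b)

up : ∀ {b} → TEv (suc b)
up = pair zero (fsuc zero)

up-is-event : ∀ κ {b} → IsEvent κ (suc b) up
up-is-event τ₂ = λ ()
up-is-event τ₃ = (λ ()) , inj₁ refl

up-step : ∀ b j → j < suc b → Step (suc b) (embed (suc b) j) up (embed (suc b) (suc j))
up-step b j j<b = z≤n , trans (embed-exact (suc b) (suc j) j<b)
                          (trans (+-comm 1 j) (cong (_+ 1) (sym (embed-exact (suc b) j (<⇒≤ j<b)))))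

grp-is-event : ∀ κ {b} (g : Fin (suc b)) → IsEvent κ b (grp g)
grp-is-event τ₂ _ = tt
grp-is-event τ₃ _ = tt

zero-step : ∀ {b} (s : Fin (suc b)) → Step b s (grp zero) s
zero-step {b} s = sym (trans (cong (_% suc b) (+-identityʳ (toℕ s))) (m<n⇒m%n≡m (toℕ<n s)))

module Witness (κ : Kind) (b′ : ℕ) where

  b : ℕ
  b = suc b′

  -- number of k- and u-edges on the way from h_{3,0,0}
  height : HState → ℕ
  height (h0 j) = j
  height (h1 j) = suc j

  signature : HEv → TEv b
  signature k = up
  signature u = up
  signature z = grp zero

  signature-is-event : ∀ e → IsEvent κ b (signature e)
  signature-is-event k = up-is-event κ
  signature-is-event u = up-is-event κ
  signature-is-event z = grp-is-event κ zero

  homomorphic : ∀ {s e s'} → HTrans b s e s' →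
    Step b (embed b (height s)) (signature e) (embed b (height s'))
  homomorphic (k0 {j} j<b) = up-step b′ j j<b
  homomorphic u0           = up-step b′ 0 (s≤s z≤n)
  homomorphic (k1 {j} j<b) = up-step b′ (suc j) j<b
  homomorphic z1           = zero-step (embed b b)

  region : Region κ b
  region = record
    { sup   = λ s → embed b (height s)
    ; sig   = signature
    ; sigEv = signature-is-event
    ; hom   = homomorphic
    }

  -- h_{3,1,b-1} is mapped to the top state, where (0,1) is blocked.
  solves : SolvesK region
  solves = top⇒up-blocked refl refl (embed-exact b b ≤-refl)

lemma5 : (b : ℕ) → 2 ≤ b → (κ : Kind) →
    ((R : Region κ b) → SolvesK R →
      (Is10 (sig R k) ⊎ Is01 (sig R k)) × InE0 (sig R z))
    × (Σ[ R ∈ Region κ b ] (SolvesK R × Is01 (sig R k) × sig R z ≡ grp zero))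
lemma5 (suc (suc c)) (s≤s (s≤s _)) κ =
  SolvingRegion.signatures c ,
  ( Witness.region κ (suc c)
  , Witness.solves κ (suc c)
  , (zero , fsuc zero , refl , refl , refl)
  , refl )
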